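{- Let $G$ be a connected finite $\delta$-hyperbolic graph. Every vertex $x$ of $G$ satisfies $d(x,C_{\le 2\delta}(G))+rad(G)+2\delta\ge e(x)\ge d(x,C_{\le 2\delta}(G))+rad(G)$ and $d(x,C(G))+rad(G)-4\delta\le e(x)\le d(x,C(G))+rad(G)$.
   Context: $G$ is $\delta$-hyperbolic if for any four vertices $u,v,w,x$ the two larger of $d(u,v)+d(w,x)$, $d(u,w)+d(v,x)$, $d(u,x)+d(v,w)$ differ by at most $2\delta$ ($d$ = shortest-path distance); $d(x,S)=\min_{u\in S}d(x,u)$. $e(v)=\max_u d(v,u)$, $rad(G)=\min_v e(v)$, $C_{\le k}(G)=\{v: e(v)\le rad(G)+k\}$, $C(G)=C_{\le 0}(G)$. -}

module Defs where

open import Data.Nat using (ℕ; zero; suc; _+_; _≤_; _⊔_; _⊓_; _≤ᵇ_)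
open import Data.Fin using (Fin; zero; suc)
open import Data.Bool using (Bool; true; false; if_then_else_)
open import Data.Maybe using (Maybe; just; nothing; fromMaybe)
open import Data.Product using (∃; _×_)
open import Relation.Nullary using (¬_)
open import Function using (_∘_)

record IsSimpleGraph {n : ℕ} (Adj : Fin n → Fin n → Set) : Set where
  field
    sym   : ∀ x y → Adj x y → Adj y x
    irrefl : ∀ x → ¬ Adj x x

data Walk {n : ℕ} (Adj : Fin n → Fin n → Set) : Fin n → Fin n → ℕ → Set where
  here : ∀ {x} → Walk Adj x x 0
  step : ∀ {x y z k} → Adj x y → Walk Adj y z k → Walk Adj x z (suc k)

Connected : {n : ℕ} → (Fin n → Fin n → Set) → Set
Connected {n} Adj = ∀ (x y : Fin n) → ∃ λ k → Walk Adj x y k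

IsShortestPathDist : {n : ℕ} → (Fin n → Fin n → Set) → (Fin n → Fin n → ℕ) → Set
IsShortestPathDist {n} Adj d =
  ∀ (x y : Fin n) → Walk Adj x y (d x y) × (∀ k → Walk Adj x y k → d x y ≤ k)

maxF : ∀ {n} → (Fin n → ℕ) → ℕ
maxF {zero}  f = 0
maxF {suc n} f = f zero ⊔ maxF (f ∘ suc)

minF : ∀ {n} → (Fin (suc n) → ℕ) → ℕ
minF {zero}  f = f zero
minF {suc n} f = f zero ⊓ minF (f ∘ suc)

minOn : ∀ {n} → (Fin n → Bool) → (Fin n → ℕ) → Maybe ℕ
minOn {zero}  S f = nothing
minOn {suc n} S f with minOn (S ∘ suc) (f ∘ suc)
... | nothing = if S zero then just (f zero) else nothing
... | just m  = just (if S zero then f zero ⊓ m else m)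

module _ {m : ℕ} (d : Fin (suc m) → Fin (suc m) → ℕ) where

  ecc : Fin (suc m) → ℕ
  ecc v = maxF (d v)

  rad : ℕ
  rad = minF ecc

  inCenterLe : ℕ → Fin (suc m) → Bool
  inCenterLe k v = ecc v ≤ᵇ rad + k

  -- d(x,S) = min_{u ∈ S} d(x,u); the value 0 for an empty S is a dummy
  -- convention (only used for the nonempty sets C_{≤k}(G)).
  distToSet : Fin (suc m) → (Fin (suc m) → Bool) → ℕ
  distToSet x S = fromMaybe 0 (minOn S (d x))

med3 : ℕ → ℕ → ℕ → ℕ
med3 a b c = (a ⊓ b) ⊔ (b ⊓ c) ⊔ (a ⊓ c)

-- δ-hyperbolicity, with the parameter twoδ = 2δ ∈ ℕ:
-- the two larger of the three distance sums differ by at most 2δ.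
Hyperbolic : {n : ℕ} → (Fin n → Fin n → ℕ) → ℕ → Set
Hyperbolic {n} d twoδ =
  ∀ (u v w x : Fin n) →
    let a = d u v + d w x
        b = d u w + d v x
        c = d u x + d v w
    in a ⊔ b ⊔ c ≤ med3 a b c + twoδ

-- The upper bounds on e(x) only use that e is 1-Lipschitz.  For the first
-- lower bound, walk from x along a geodesic towards a vertex c with
-- e(c) = rad and stop after e(x) − rad steps: the four-point condition for
-- x, c, the stopping point y and any v gives d(y,v) ≤ rad + 2δ, so
-- y ∈ C_{≤2δ}(G).  For the last bound let c be a vertex of C(G) closest to x;
-- if d(x,c) + rad > e(x) + 4δ, the vertex at distance 2δ + 1 from c on a
-- geodesic towards x is central by the same argument, yet closer to x.
module Submission where

open import Defs
open import Data.Nat using (ℕ; zero; suc; _+_; _*_; _∸_; _⊔_; _≤_; _<_; z≤n; s≤s)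
open import Data.Nat.Properties
open import Data.Nat.Tactic.RingSolver using (solve-∀)
open import Data.Fin using (Fin; zero; suc)
open import Data.Bool using (Bool; true; false; T)
open import Data.Unit using (tt)
open import Data.Maybe using (just; nothing)
open import Data.Maybe.Properties using (just-injective)
open import Data.Product using (∃; _×_; _,_; proj₁; proj₂)
open import Data.Sum using (inj₁; inj₂)
open import Relation.Nullary using (¬_)
open import Relation.Binary.PropositionalEquality
open import Function using (_∘_)

maxF-upper : ∀ {n} (f : Fin n → ℕ) u → f u ≤ maxF f
maxF-upper f zero    = m≤m⊔n _ _
maxF-upper f (suc u) = ≤-trans (maxF-upper (f ∘ suc) u) (m≤n⊔m _ _)

maxF-least : ∀ {n} (f : Fin n → ℕ) {b} → (∀ u → f u ≤ b) → maxF f ≤ b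
maxF-least {zero}  f h = z≤n
maxF-least {suc n} f h = ⊔-lub (h zero) (maxF-least (f ∘ suc) (h ∘ suc))

minF-lower : ∀ {n} (f : Fin (suc n) → ℕ) u → minF f ≤ f u
minF-lower {zero}  f zero    = ≤-refl
minF-lower {suc n} f zero    = m⊓n≤m _ _
minF-lower {suc n} f (suc u) = ≤-trans (m⊓n≤n _ _) (minF-lower (f ∘ suc) u)

minF-attained : ∀ {n} (f : Fin (suc n) → ℕ) → ∃ λ u → minF f ≡ f u
minF-attained {zero}  f = zero , refl
minF-attained {suc n} f with ⊓-sel (f zero) (minF (f ∘ suc))
... | inj₁ eq = zero , eq
... | inj₂ eq with minF-attained (f ∘ suc)
...   | u , eq′ = suc u , trans eq eq′

minOn-lower : ∀ {n} (S : Fin n → Bool) (f : Fin n → ℕ) u → T (S u) →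
              ∃ λ m → minOn S f ≡ just m × m ≤ f u
minOn-lower {suc n} S f zero Su with minOn (S ∘ suc) (f ∘ suc)
... | nothing with S zero
...   | true = _ , refl , ≤-refl
minOn-lower {suc n} S f zero Su | just m with S zero
...   | true = _ , refl , m⊓n≤m _ _
minOn-lower {suc n} S f (suc u) Su
  with minOn (S ∘ suc) (f ∘ suc) | minOn-lower (S ∘ suc) (f ∘ suc) u Su
... | nothing | _ , () , _
... | just m  | _ , refl , m≤fu with S zero
...   | true  = _ , refl , ≤-trans (m⊓n≤n _ _) m≤fu
...   | false = _ , refl , m≤fu

minOn-attained : ∀ {n} (S : Fin n → Bool) (f : Fin n → ℕ) {m} → minOn S f ≡ just m →
                 ∃ λ u → T (S u) × m ≡ f u
minOn-attained {suc n} S f eq with minOn (S ∘ suc) (f ∘ suc) in eq′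
... | nothing with S zero in S0
...   | true = zero , subst T (sym S0) tt , sym (just-injective eq)
minOn-attained {suc n} S f eq | just m with S zero in S0
... | false with minOn-attained (S ∘ suc) (f ∘ suc) eq′
...   | u , Su , m≡fu = suc u , Su , trans (sym (just-injective eq)) m≡fu
minOn-attained {suc n} S f eq | just m | true with ⊓-sel (f zero) m
... | inj₁ sel = zero , subst T (sym S0) tt , trans (sym (just-injective eq)) sel
... | inj₂ sel with minOn-attained (S ∘ suc) (f ∘ suc) eq′
...   | u , Su , m≡fu = suc u , Su , trans (sym (just-injective eq)) (trans sel m≡fu)

distToSet-lower : ∀ {m} (d : Fin (suc m) → Fin (suc m) → ℕ) x S {u} → T (S u) →
                  distToSet d x S ≤ d x u
distToSet-lower d x S {u} Su with minOn-lower S (d x) u Su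
... | _ , eq , m≤dxu rewrite eq = m≤dxu

distToSet-attained : ∀ {m} (d : Fin (suc m) → Fin (suc m) → ℕ) x S {u} → T (S u) →
                     ∃ λ w → T (S w) × distToSet d x S ≡ d x w
distToSet-attained d x S {u} Su with minOn-lower S (d x) u Su
... | m , eq , _ with minOn-attained S (d x) eq
...   | w , Sw , m≡dxw rewrite eq = w , Sw , m≡dxw

module Walks {n : ℕ} (Adj : Fin n → Fin n → Set) where

  walk-++ : ∀ {x y z k l} → Walk Adj x y k → Walk Adj y z l → Walk Adj x z (k + l)
  walk-++ here       q = q
  walk-++ (step a p) q = step a (walk-++ p q)

  walk-splitAt : ∀ k {l x z} → Walk Adj x z (k + l) →
                 ∃ λ y → Walk Adj x y k × Walk Adj y z l
  walk-splitAt zero    p          = _ , here , p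
  walk-splitAt (suc k) (step a p) with walk-splitAt k p
  ... | y , q , r = y , step a q , r

  walk-reverse : IsSimpleGraph Adj → ∀ {x y k} → Walk Adj x y k → Walk Adj y x k
  walk-reverse G here                = here
  walk-reverse G {k = suc k} (step a p) =
    subst (Walk Adj _ _) (+-comm k 1)
      (walk-++ (walk-reverse G p) (step (IsSimpleGraph.sym G _ _ a) here))

four-point : ∀ {n} (d : Fin n → Fin n → ℕ) {s} → Hyperbolic d s →
             ∀ u v w x {N} → d u w + d v x + s ≤ N → d u x + d v w + s ≤ N →
             d u v + d w x ≤ N
four-point d {s} hyp u v w x {N} b+s≤N c+s≤N = begin
  a                 ≤⟨ ≤-trans (m≤m⊔n a b) (m≤m⊔n (a ⊔ b) c) ⟩
  a ⊔ b ⊔ c         ≤⟨ hyp u v w x ⟩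
  med3 a b c + s    ≤⟨ +-monoˡ-≤ s med3≤b⊔c ⟩
  (b ⊔ c) + s       ≡⟨ +-distribʳ-⊔ s b c ⟩
  (b + s) ⊔ (c + s) ≤⟨ ⊔-lub b+s≤N c+s≤N ⟩
  N                 ∎
  where
  open ≤-Reasoning
  a b c : ℕ
  a = d u v + d w x
  b = d u w + d v x
  c = d u x + d v w
  med3≤b⊔c : med3 a b c ≤ b ⊔ c
  med3≤b⊔c = ⊔-lub (⊔-lub (≤-trans (m⊓n≤n a b) (m≤m⊔n b c)) (≤-trans (m⊓n≤m b c) (m≤m⊔n b c)))
                   (≤-trans (m⊓n≤n a c) (m≤n⊔m b c))

module ShortestPaths {m : ℕ} {Adj : Fin (suc m) → Fin (suc m) → Set} (G : IsSimpleGraph Adj)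
                     {d : Fin (suc m) → Fin (suc m) → ℕ} (sp : IsShortestPathDist Adj d) where
  open Walks Adj

  geodesic : ∀ x y → Walk Adj x y (d x y)
  geodesic x y = proj₁ (sp x y)

  d-≤-walk : ∀ {x y k} → Walk Adj x y k → d x y ≤ k
  d-≤-walk {x} {y} = proj₂ (sp x y) _

  d-triangle : ∀ x y z → d x z ≤ d x y + d y z
  d-triangle x y z = d-≤-walk (walk-++ (geodesic x y) (geodesic y z))

  d-sym : ∀ x y → d x y ≡ d y x
  d-sym x y = ≤-antisym (d-≤-walk (walk-reverse G (geodesic y x)))
                        (d-≤-walk (walk-reverse G (geodesic x y)))

  geodesic-point : ∀ x y {k} → k ≤ d x y → ∃ λ z → d x z ≤ k × k + d z y ≤ d x y
  geodesic-point x y {k} k≤dxy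
    with walk-splitAt k (subst (Walk Adj x y) (sym (m+[n∸m]≡n k≤dxy)) (geodesic x y))
  ... | z , p , q =
    z , d-≤-walk p , subst (k + d z y ≤_) (m+[n∸m]≡n k≤dxy) (+-monoʳ-≤ k (d-≤-walk q))

  d-≤-ecc : ∀ x v → d x v ≤ ecc d x
  d-≤-ecc x = maxF-upper (d x)

  ecc-≤-d+ecc : ∀ x y → ecc d x ≤ d x y + ecc d y
  ecc-≤-d+ecc x y =
    maxF-least (d x) (λ v → ≤-trans (d-triangle x y v) (+-monoʳ-≤ (d x y) (d-≤-ecc y v)))

  rad-≤-ecc : ∀ x → rad d ≤ ecc d x
  rad-≤-ecc = minF-lower (ecc d)

  center : Fin (suc m)
  center = proj₁ (minF-attained (ecc d))

  ecc-center : ecc d center ≡ rad d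
  ecc-center = sym (proj₂ (minF-attained (ecc d)))

  inCenterLe-intro : ∀ {k v} → ecc d v ≤ rad d + k → T (inCenterLe d k v)
  inCenterLe-intro = ≤⇒≤ᵇ

  inCenterLe-elim : ∀ {k v} → T (inCenterLe d k v) → ecc d v ≤ rad d + k
  inCenterLe-elim {k} {v} = ≤ᵇ⇒≤ (ecc d v) (rad d + k)

  center-inCenterLe : ∀ k → T (inCenterLe d k center)
  center-inCenterLe k = inCenterLe-intro (≤-trans (≤-reflexive ecc-center) (m≤m+n (rad d) k))

  ecc≤distToCenterLe+rad+k : ∀ k x → ecc d x ≤ distToSet d x (inCenterLe d k) + rad d + k
  ecc≤distToCenterLe+rad+k k x
    with distToSet-attained d x (inCenterLe d k) (center-inCenterLe k)
  ... | y , y∈C , dist≡dxy = begin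
    ecc d x                                      ≤⟨ ecc-≤-d+ecc x y ⟩
    d x y + ecc d y                              ≤⟨ +-monoʳ-≤ (d x y) (inCenterLe-elim y∈C) ⟩
    d x y + (rad d + k)                          ≡⟨ +-assoc (d x y) (rad d) k ⟨
    d x y + rad d + k                            ≡⟨ cong (λ t → t + rad d + k) dist≡dxy ⟨
    distToSet d x (inCenterLe d k) + rad d + k   ∎
    where open ≤-Reasoning

  module _ {twoδ : ℕ} (hyp : Hyperbolic d twoδ) where
    open ≤-Reasoning

    nearby-almost-central-vertex :
      ∀ x → ∃ λ y → T (inCenterLe d twoδ y) × d x y + rad d ≤ ecc d x
    nearby-almost-central-vertex x =
        y , inCenterLe-intro (maxF-least (d y) dyv≤R+2δ)
      , subst (d x y + R ≤_) k+R≡ecc (+-monoˡ-≤ R dxy≤k)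
      where
      R : ℕ
      R = rad d
      c : Fin (suc m)
      c = center
      k : ℕ
      k = ecc d x ∸ R
      k+R≡ecc : k + R ≡ ecc d x
      k+R≡ecc = m∸n+n≡m (rad-≤-ecc x)
      k≤dxc : k ≤ d x c
      k≤dxc = +-cancelʳ-≤ R k (d x c)
        (subst₂ _≤_ (sym k+R≡ecc) (cong (d x c +_) ecc-center) (ecc-≤-d+ecc x c))
      y : Fin (suc m)
      y = proj₁ (geodesic-point x c k≤dxc)
      dxy≤k : d x y ≤ k
      dxy≤k = proj₁ (proj₂ (geodesic-point x c k≤dxc))
      k+dyc≤dxc : k + d y c ≤ d x c
      k+dyc≤dxc = proj₂ (proj₂ (geodesic-point x c k≤dxc))
      regroup : ∀ a b c e → a + b + c + e ≡ a + c + (b + e)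
      regroup = solve-∀
      dyv≤R+2δ : ∀ v → d y v ≤ R + twoδ
      dyv≤R+2δ v = +-cancelˡ-≤ (d x c) _ _ (four-point d hyp x c y v
        (begin
          d x y + d c v + twoδ  ≤⟨ +-monoˡ-≤ twoδ (+-mono-≤ (≤-trans dxy≤k k≤dxc)
                                     (≤-trans (d-≤-ecc c v) (≤-reflexive ecc-center))) ⟩
          d x c + R + twoδ      ≡⟨ +-assoc (d x c) R twoδ ⟩
          d x c + (R + twoδ)    ∎)
        (begin
          d x v + d c y + twoδ  ≤⟨ +-monoˡ-≤ twoδ (+-mono-≤ (d-≤-ecc x v) (≤-reflexive (d-sym c y))) ⟩
          ecc d x + d y c + twoδ ≡⟨ cong (λ e → e + d y c + twoδ) k+R≡ecc ⟨
          k + R + d y c + twoδ  ≡⟨ regroup k R (d y c) twoδ ⟩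
          k + d y c + (R + twoδ) ≤⟨ +-monoˡ-≤ (R + twoδ) k+dyc≤dxc ⟩
          d x c + (R + twoδ)    ∎))

    closer-central-vertex : ∀ x {c} → T (inCenterLe d 0 c) → ecc d x + 2 * twoδ < d x c + rad d →
                            ∃ λ y → T (inCenterLe d 0 y) × d x y < d x c
    closer-central-vertex x {c} c∈C far =
      y , inCenterLe-intro (maxF-least (d y) dyv≤R) , dxy<dxc
      where
      R : ℕ
      R = rad d
      t : ℕ
      t = suc twoδ
      far′ : t + ecc d x + twoδ ≤ d c x + R
      far′ = subst₂ _≤_ (spread (ecc d x) twoδ) (cong (_+ R) (d-sym x c)) far
        where
        spread : ∀ e s → suc (e + 2 * s) ≡ suc s + e + s
        spread = solve-∀
      t≤dcx : t ≤ d c x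
      t≤dcx = +-cancelʳ-≤ R t (d c x) (begin
        t + R                ≤⟨ +-monoʳ-≤ t (rad-≤-ecc x) ⟩
        t + ecc d x          ≤⟨ m≤m+n (t + ecc d x) twoδ ⟩
        t + ecc d x + twoδ   ≤⟨ far′ ⟩
        d c x + R            ∎)
      y : Fin (suc m)
      y = proj₁ (geodesic-point c x t≤dcx)
      dcy≤t : d c y ≤ t
      dcy≤t = proj₁ (proj₂ (geodesic-point c x t≤dcx))
      t+dyx≤dcx : t + d y x ≤ d c x
      t+dyx≤dcx = proj₂ (proj₂ (geodesic-point c x t≤dcx))
      dcv≤R : ∀ v → d c v ≤ R
      dcv≤R v = ≤-trans (d-≤-ecc c v) (subst (ecc d c ≤_) (+-identityʳ R) (inCenterLe-elim c∈C))
      regroup : ∀ a b e → a + b + suc e ≡ suc e + b + a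
      regroup = solve-∀
      dyv≤R : ∀ v → d y v ≤ R + 0
      dyv≤R v = subst (d y v ≤_) (sym (+-identityʳ R)) (+-cancelˡ-≤ (d c x) _ _
        (four-point d hyp c x y v
          (begin
            d c y + d x v + twoδ  ≤⟨ +-monoˡ-≤ twoδ (+-mono-≤ dcy≤t (d-≤-ecc x v)) ⟩
            t + ecc d x + twoδ    ≤⟨ far′ ⟩
            d c x + R             ∎)
          (begin
            d c v + d x y + twoδ  ≤⟨ +-monoˡ-≤ twoδ (+-mono-≤ (dcv≤R v) (≤-reflexive (d-sym x y))) ⟩
            R + d y x + twoδ      ≤⟨ +-monoʳ-≤ (R + d y x) (n≤1+n twoδ) ⟩
            R + d y x + t         ≡⟨ regroup R (d y x) twoδ ⟩
            t + d y x + R         ≤⟨ +-monoˡ-≤ R t+dyx≤dcx ⟩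
            d c x + R             ∎)))
      dxy<dxc : d x y < d x c
      dxy<dxc = begin-strict
        d x y          ≡⟨ d-sym x y ⟩
        d y x          <⟨ s≤s (m≤n+m (d y x) twoδ) ⟩
        t + d y x      ≤⟨ t+dyx≤dcx ⟩
        d c x          ≡⟨ d-sym c x ⟩
        d x c          ∎

    distToCenterLe+rad≤ecc : ∀ x → distToSet d x (inCenterLe d twoδ) + rad d ≤ ecc d x
    distToCenterLe+rad≤ecc x =
      let (y , y∈C , dxy+R≤ecc) = nearby-almost-central-vertex x in
      ≤-trans (+-monoˡ-≤ (rad d) (distToSet-lower d x (inCenterLe d twoδ) y∈C)) dxy+R≤ecc

    distToCenter+rad≤ecc+4δ : ∀ x → distToSet d x (inCenterLe d 0) + rad d ≤ ecc d x + 2 * twoδ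
    distToCenter+rad≤ecc+4δ x =
      let (c , c∈C , dist≡dxc) = distToSet-attained d x (inCenterLe d 0) (center-inCenterLe 0) in
      subst (λ t → t + rad d ≤ ecc d x + 2 * twoδ) (sym dist≡dxc) (≮⇒≥ (not-far c∈C dist≡dxc))
      where
      not-far : ∀ {c} → T (inCenterLe d 0 c) → distToSet d x (inCenterLe d 0) ≡ d x c →
                ¬ (ecc d x + 2 * twoδ < d x c + rad d)
      not-far c∈C dist≡dxc far =
        let (y , y∈C , dxy<dxc) = closer-central-vertex x c∈C far in
        <⇒≱ dxy<dxc (subst (_≤ d x y) dist≡dxc (distToSet-lower d x (inCenterLe d 0) y∈C))

theorem25 : ∀ {m : ℕ} (Adj : Fin (suc m) → Fin (suc m) → Set) → IsSimpleGraph Adj → Connected Adj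
    → (d : Fin (suc m) → Fin (suc m) → ℕ) → IsShortestPathDist Adj d
    → (twoδ : ℕ) → Hyperbolic d twoδ
    → ∀ (x : Fin (suc m))
    → (ecc d x ≤ distToSet d x (inCenterLe d twoδ) + rad d + twoδ)
    × (distToSet d x (inCenterLe d twoδ) + rad d ≤ ecc d x)
    × (distToSet d x (inCenterLe d 0) + rad d ≤ ecc d x + 2 * twoδ)
    × (ecc d x ≤ distToSet d x (inCenterLe d 0) + rad d)
theorem25 Adj G _ d sp twoδ hyp x =
    ecc≤distToCenterLe+rad+k twoδ x
  , distToCenterLe+rad≤ecc hyp x
  , distToCenter+rad≤ecc+4δ hyp x
  , subst (ecc d x ≤_) (+-identityʳ _) (ecc≤distToCenterLe+rad+k 0 x)
  where open ShortestPaths G sp
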